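{- Let $k\ge 1$ and let $T$ be a finite complete multidigraph whose arc set is the union of $k$ quasi-orders $P_1,\dots,P_k$ on $V(T)$. Then there exist a probability distribution $w$ on $V(T)$ and a partition of $V(T)$ into sets $T_1,T_2,\dots,T_k$ such that for every $i\in\{1,\dots,k\}$ and every $x\in T_i$, $w(N^-_i(x))\ge \frac{1}{2k}$.
   Context: A quasi-order on a set $S$ is a reflexive transitive relation; it is viewed as a digraph on $S$ whose arcs are the pairs $(x,y)$ with $x\le y$. A complete multidigraph is a directed graph in which multiple arcs and directed cycles of length two are allowed and in which between any two distinct vertices there is at least one arc. "The arc set is the union of $k$ quasi-orders $P_1,\dots,P_k$" means every arc $(x,y)$ of $T$ satisfies $x\le_i y$ for some $i$, and every pair $x\le_i y$ with $x\neq y$ is an arc of $T$. $N^-_i(x)$ denotes the closed in-neighbourhood of $x$ in the digraph of $P_i$, i.e. $\{x\}\cup\{y : (y,x)\in P_i\}$. A probability distribution on a finite set $S$ is a function $w:S\to[0,1]$ with $w(S)=\sum_{x\in S}w(x)=1$, and $w(X)=\sum_{x\in X}w(x)$ for $X\subseteq S$. Parts of the partition are allowed to be empty. -}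

module Defs where

open import Data.Nat as ℕ using (ℕ; zero; suc; NonZero)
open import Data.Nat.Properties using (m*n≢0)
open import Data.Fin using (Fin; zero; suc; _≟_)
open import Relation.Nullary using (yes; no)
open import Data.Bool using (Bool; true; false; if_then_else_)
open import Data.Integer using (+_)
open import Data.Rational using (ℚ; 0ℚ; _+_; _/_)
open import Data.Product using (∃; _×_)
open import Data.Sum using (_⊎_)
open import Relation.Binary.PropositionalEquality using (_≡_; _≢_)

Rel : ℕ → Set
Rel n = Fin n → Fin n → Bool

IsQuasiOrder : ∀ {n} → Rel n → Set
IsQuasiOrder {n} R =
  (∀ (x : Fin n) → R x x ≡ true) ×
  (∀ (x y z : Fin n) → R x y ≡ true → R y z ≡ true → R x z ≡ true)

-- The complete multidigraph whose arc set is the union of the P i: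
-- between any two distinct vertices there is at least one arc.
IsCompleteUnion : ∀ {n k} → (Fin k → Rel n) → Set
IsCompleteUnion {n} {k} P =
  ∀ (x y : Fin n) → x ≢ y → ∃ λ (i : Fin k) → (P i x y ≡ true) ⊎ (P i y x ≡ true)

sumFin : ∀ n → (Fin n → ℚ) → ℚ
sumFin zero    f = 0ℚ
sumFin (suc n) f = f zero + sumFin n (λ j → f (suc j))

weight : ∀ {n} → (Fin n → ℚ) → (Fin n → Bool) → ℚ
weight {n} w X = sumFin n (λ y → if X y then w y else 0ℚ)

closedIn : ∀ {n} → Rel n → Fin n → Fin n → Bool
closedIn R x y with y ≟ x
... | yes _ = true
... | no  _ = R y x

inv2k : (k : ℕ) → .{{NonZero k}} → ℚ
inv2k k = (+ 1) / (2 ℕ.* k)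
  where instance _ = m*n≢0 2 k

module Submission where

-- Write y ⇒ x when y ∈ N⁻ᵢ(x) for some i, and let S be the skew-symmetric matrix
-- S(y, x) = [y ⇒ x] − [x ⇒ y]. The symmetric zero-sum game with payoff matrix S
-- has value 0: some probability distribution w satisfies Σ_y w(y) S(y, x) ≥ 0 for
-- every x. This follows from Ville's theorem of the alternative, a consequence of
-- Gordan's theorem, which is proved by Fourier–Motzkin elimination. Completeness
-- of T gives 1 + S(y, x) ≤ 2 [y ⇒ x], hence 1 ≤ Σ_y w(y) (1 + S(y, x)) ≤
-- 2 Σᵢ w(N⁻ᵢ(x)), and x goes into a part Tᵢ with w(N⁻ᵢ(x)) ≥ 1/(2k).

open import Defs
open import Data.Nat as ℕ using (ℕ; zero; suc; NonZero)
import Data.Nat.Properties as ℕP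
open import Data.Fin using (Fin; zero; suc; _≟_; _↑ˡ_; _↑ʳ_; splitAt)
open import Data.Fin.Properties using (splitAt-↑ˡ; splitAt-↑ʳ; any?)
open import Data.Vec.Functional using (Vector; tail) renaming (_∷_ to _◂_)
open import Data.Rational as ℚ
  using (ℚ; 0ℚ; 1ℚ; _≤_; _<_; _+_; _*_; -_; _-_; 1/_; _⊓_; _⊔_)
import Data.Rational.Properties as ℚP
import Data.Rational.Unnormalised as ℚᵘ
import Data.Rational.Unnormalised.Properties as ℚᵘP
import Data.Integer as ℤ
open import Agda.Builtin.Int using (pos)
import Data.Integer.Properties as ℤP
open import Data.Rational.Solver using (module +-*-Solver)
open +-*-Solver using (solve; con; _:+_; _:*_; :-_; _:=_; _:-_)
open import Data.List using (List; []; _∷_; _++_; map; filter; allFin; cartesianProductWith)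
open import Data.List.Membership.Propositional using (_∈_)
open import Data.List.Membership.Propositional.Properties
  using (∈-map⁺; ∈-map⁻; ∈-++⁺ˡ; ∈-++⁺ʳ; ∈-++⁻; ∈-filter⁺; ∈-filter⁻;
         ∈-cartesianProductWith⁺; ∈-cartesianProductWith⁻; ∈-allFin)
open import Data.List.Relation.Unary.Any using (Any; here; there)
import Data.List.Relation.Unary.Any.Properties as Any
open import Data.Product using (∃; ∃₂; _×_; _,_; proj₁; proj₂)
open import Data.Sum using (_⊎_; inj₁; inj₂; [_,_]; [_,_]′)
open import Data.Empty using (⊥-elim)
open import Data.Bool as Bool using (Bool; true; false; if_then_else_)
open import Relation.Nullary using (Dec; yes; no; does)
open import Relation.Nullary.Decidable using (from-yes)
open import Relation.Binary.PropositionalEquality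
  using (_≡_; refl; sym; trans; cong; cong₂; subst; subst₂; module ≡-Reasoning)
open import Relation.Binary.Definitions using (tri<; tri≈; tri>)
open import Function using (_∘_)

0<1 : 0ℚ < 1ℚ
0<1 = ℚP.positive⁻¹ 1ℚ

p≤p+q : ∀ {p q} → 0ℚ ≤ q → p ≤ p + q
p≤p+q {p} 0≤q = subst (_≤ p + _) (ℚP.+-identityʳ p) (ℚP.+-monoʳ-≤ p 0≤q)

q≤p+q : ∀ {p q} → 0ℚ ≤ p → q ≤ p + q
q≤p+q {p} {q} 0≤p = subst (_≤ p + q) (ℚP.+-identityˡ q) (ℚP.+-monoˡ-≤ q 0≤p)

p-1<p : ∀ p → p - 1ℚ < p
p-1<p p = subst (p - 1ℚ <_) (ℚP.+-identityʳ p) (ℚP.+-monoʳ-< p (ℚP.neg-antimono-< 0<1))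

p<p+1 : ∀ p → p < p + 1ℚ
p<p+1 p = subst (_< p + 1ℚ) (ℚP.+-identityʳ p) (ℚP.+-monoʳ-< p 0<1)

+-nonNeg : ∀ {p q} → 0ℚ ≤ p → 0ℚ ≤ q → 0ℚ ≤ p + q
+-nonNeg 0≤p 0≤q = ℚP.≤-trans 0≤p (p≤p+q 0≤q)

*-nonNeg : ∀ {p q} → 0ℚ ≤ p → 0ℚ ≤ q → 0ℚ ≤ p * q
*-nonNeg {p} {q} 0≤p 0≤q = ℚP.nonNegative⁻¹ _
  {{ℚP.nonNeg*nonNeg⇒nonNeg p {{ℚ.nonNegative 0≤p}} q {{ℚ.nonNegative 0≤q}}}}

*-pos : ∀ {p q} → 0ℚ < p → 0ℚ < q → 0ℚ < p * q
*-pos {p} {q} 0<p 0<q = ℚP.positive⁻¹ _ {{ℚP.pos*pos⇒pos p {{ℚ.positive 0<p}} q {{ℚ.positive 0<q}}}}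

<-⊓ : ∀ {p q r} → p < q → p < r → p < q ⊓ r
<-⊓ {p} {q} {r} p<q p<r with ℚP.⊓-sel q r
... | inj₁ eq = subst (p <_) (sym eq) p<q
... | inj₂ eq = subst (p <_) (sym eq) p<r

⊔-< : ∀ {p q r} → p < r → q < r → p ⊔ q < r
⊔-< {p} {q} {r} p<r q<r with ℚP.⊔-sel p q
... | inj₁ eq = subst (_< r) (sym eq) p<r
... | inj₂ eq = subst (_< r) (sym eq) q<r

p+p≡0⇒p≡0 : ∀ p → p + p ≡ 0ℚ → p ≡ 0ℚ
p+p≡0⇒p≡0 p p+p≡0 with ℚP.<-cmp p 0ℚ
... | tri< p<0 _ _ = ⊥-elim (ℚP.<⇒≢ (subst (p + p <_) (ℚP.+-identityʳ 0ℚ) (ℚP.+-mono-< p<0 p<0)) p+p≡0)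
... | tri≈ _ p≡0 _ = p≡0
... | tri> _ _ 0<p = ⊥-elim (ℚP.<⇒≢ (subst (_< p + p) (ℚP.+-identityʳ 0ℚ) (ℚP.+-mono-< 0<p 0<p)) (sym p+p≡0))

-1*p≡-p : ∀ p → - 1ℚ * p ≡ - p
-1*p≡-p p = trans (sym (ℚP.neg-distribˡ-* 1ℚ p)) (cong -_ (ℚP.*-identityˡ p))

-p<0⇒0<p : ∀ {p} → - p < 0ℚ → 0ℚ < p
-p<0⇒0<p {p} -p<0 = subst₂ _<_ (ℚP.+-inverseˡ p) (ℚP.+-identityˡ p) (ℚP.+-monoˡ-< p -p<0)

p-q≡0⇒p≡q : ∀ {p q} → p - q ≡ 0ℚ → p ≡ q
p-q≡0⇒p≡q {p} {q} p-q≡0 = begin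
  p            ≡⟨ solve 2 (λ p q → p := (p :- q) :+ q) refl p q ⟩
  (p - q) + q  ≡⟨ cong (_+ q) p-q≡0 ⟩
  0ℚ + q       ≡⟨ ℚP.+-identityˡ q ⟩
  q            ∎
  where open ≡-Reasoning

+<0⇒<-neg : ∀ x y → x + y < 0ℚ → y < - x
+<0⇒<-neg x y x+y<0 = subst₂ _<_
  (solve 2 (λ x y → (x :+ y) :+ (:- x) := y) refl x y) (ℚP.+-identityˡ (- x))
  (ℚP.+-monoˡ-< (- x) x+y<0)

<-neg⇒+<0 : ∀ x y → x < - y → x + y < 0ℚ
<-neg⇒+<0 x y x<-y = subst (x + y <_) (ℚP.+-inverseˡ y) (ℚP.+-monoˡ-< y x<-y)

-- Junk value: inv 0ℚ = 0ℚ.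
inv : ℚ → ℚ
inv p with p ℚP.≟ 0ℚ
... | yes _  = 0ℚ
... | no p≢0 = (1/ p) {{ℚ.≢-nonZero p≢0}}

inv-inverseˡ : ∀ {p} → 0ℚ < p → inv p * p ≡ 1ℚ
inv-inverseˡ {p} 0<p with p ℚP.≟ 0ℚ
... | yes p≡0 = ⊥-elim (ℚP.<⇒≢ 0<p (sym p≡0))
... | no p≢0 = ℚP.*-inverseˡ p {{ℚ.≢-nonZero p≢0}}

inv-pos : ∀ {p} → 0ℚ < p → 0ℚ < inv p
inv-pos {p} 0<p with p ℚP.≟ 0ℚ
... | yes p≡0 = ⊥-elim (ℚP.<⇒≢ 0<p (sym p≡0))
... | no p≢0 = ℚP.positive⁻¹ _ {{ℚP.1/pos⇒pos p {{ℚ.positive 0<p}}}}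

sumFin-cong : ∀ n {f g : Fin n → ℚ} → (∀ j → f j ≡ g j) → sumFin n f ≡ sumFin n g
sumFin-cong zero    f≗g = refl
sumFin-cong (suc n) f≗g = cong₂ _+_ (f≗g zero) (sumFin-cong n (f≗g ∘ suc))

sumFin-0 : ∀ n → sumFin n (λ _ → 0ℚ) ≡ 0ℚ
sumFin-0 zero    = refl
sumFin-0 (suc n) = trans (ℚP.+-identityˡ _) (sumFin-0 n)

sumFin-+ : ∀ n (f g : Fin n → ℚ) → sumFin n (λ j → f j + g j) ≡ sumFin n f + sumFin n g
sumFin-+ zero    f g = sym (ℚP.+-identityʳ 0ℚ)
sumFin-+ (suc n) f g =
  trans (cong ((f zero + g zero) +_) (sumFin-+ n (f ∘ suc) (g ∘ suc)))
        (solve 4 (λ a b c d → (a :+ b) :+ (c :+ d) := (a :+ c) :+ (b :+ d)) refl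
               (f zero) (g zero) (sumFin n (f ∘ suc)) (sumFin n (g ∘ suc)))

sumFin-*ˡ : ∀ n c (f : Fin n → ℚ) → sumFin n (λ j → c * f j) ≡ c * sumFin n f
sumFin-*ˡ zero    c f = sym (ℚP.*-zeroʳ c)
sumFin-*ˡ (suc n) c f =
  trans (cong (c * f zero +_) (sumFin-*ˡ n c (f ∘ suc))) (sym (ℚP.*-distribˡ-+ c (f zero) _))

sumFin-*ʳ : ∀ n c (f : Fin n → ℚ) → sumFin n (λ j → f j * c) ≡ sumFin n f * c
sumFin-*ʳ n c f = begin
  sumFin n (λ j → f j * c) ≡⟨ sumFin-cong n (λ j → ℚP.*-comm (f j) c) ⟩
  sumFin n (λ j → c * f j) ≡⟨ sumFin-*ˡ n c f ⟩
  c * sumFin n f           ≡⟨ ℚP.*-comm c _ ⟩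
  sumFin n f * c           ∎
  where open ≡-Reasoning

sumFin-swap : ∀ m n (M : Fin m → Fin n → ℚ) →
  sumFin m (λ x → sumFin n (M x)) ≡ sumFin n (λ z → sumFin m (λ x → M x z))
sumFin-swap zero    n M = sym (sumFin-0 n)
sumFin-swap (suc m) n M =
  trans (cong (sumFin n (M zero) +_) (sumFin-swap m n (M ∘ suc)))
        (sym (sumFin-+ n (M zero) (λ z → sumFin m (λ x → M (suc x) z))))

sumFin-↑ : ∀ m n (f : Fin (m ℕ.+ n) → ℚ) →
  sumFin (m ℕ.+ n) f ≡ sumFin m (λ i → f (i ↑ˡ n)) + sumFin n (λ j → f (m ↑ʳ j))
sumFin-↑ zero    n f = sym (ℚP.+-identityˡ _)
sumFin-↑ (suc m) n f =
  trans (cong (f zero +_) (sumFin-↑ m n (f ∘ suc))) (sym (ℚP.+-assoc (f zero) _ _))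

sumFin-mono : ∀ n {f g : Fin n → ℚ} → (∀ j → f j ≤ g j) → sumFin n f ≤ sumFin n g
sumFin-mono zero    f≤g = ℚP.≤-refl
sumFin-mono (suc n) f≤g = ℚP.+-mono-≤ (f≤g zero) (sumFin-mono n (f≤g ∘ suc))

sumFin-nonNeg : ∀ n {f : Fin n → ℚ} → (∀ j → 0ℚ ≤ f j) → 0ℚ ≤ sumFin n f
sumFin-nonNeg n {f} 0≤f = subst (_≤ sumFin n f) (sumFin-0 n) (sumFin-mono n 0≤f)

term≤sumFin : ∀ n {f : Fin n → ℚ} → (∀ j → 0ℚ ≤ f j) → ∀ i → f i ≤ sumFin n f
term≤sumFin (suc n) 0≤f zero    = p≤p+q (sumFin-nonNeg n (0≤f ∘ suc))
term≤sumFin (suc n) 0≤f (suc i) = ℚP.≤-trans (term≤sumFin n (0≤f ∘ suc) i) (q≤p+q (0≤f zero))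

sumFin<0 : ∀ n {f : Fin (suc n) → ℚ} → (∀ j → f j < 0ℚ) → sumFin (suc n) f < 0ℚ
sumFin<0 zero    {f} f<0 = subst (_< 0ℚ) (sym (ℚP.+-identityʳ _)) (f<0 zero)
sumFin<0 (suc n) {f} f<0 =
  subst (sumFin (suc (suc n)) f <_) (ℚP.+-identityʳ 0ℚ)
        (ℚP.+-mono-< (f<0 zero) (sumFin<0 n (f<0 ∘ suc)))

sumFin≡0⇒≡0 : ∀ n {f : Fin n → ℚ} → (∀ j → 0ℚ ≤ f j) → sumFin n f ≡ 0ℚ → ∀ i → f i ≡ 0ℚ
sumFin≡0⇒≡0 n 0≤f Σf≡0 i = ℚP.≤-antisym (subst (_ ≤_) Σf≡0 (term≤sumFin n 0≤f i)) (0≤f i)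

δ : ∀ {n} → Fin n → ℚ → Vector ℚ n
δ zero    c zero    = c
δ zero    c (suc _) = 0ℚ
δ (suc i) c zero    = 0ℚ
δ (suc i) c (suc j) = δ i c j

δ-sym : ∀ {n} (i j : Fin n) c → δ i c j ≡ δ j c i
δ-sym zero    zero    c = refl
δ-sym zero    (suc j) c = refl
δ-sym (suc i) zero    c = refl
δ-sym (suc i) (suc j) c = δ-sym i j c

δ-nonNeg : ∀ {n} (i : Fin n) {c} → 0ℚ ≤ c → ∀ j → 0ℚ ≤ δ i c j
δ-nonNeg zero    0≤c zero    = 0≤c
δ-nonNeg zero    0≤c (suc j) = ℚP.≤-refl
δ-nonNeg (suc i) 0≤c zero    = ℚP.≤-refl
δ-nonNeg (suc i) 0≤c (suc j) = δ-nonNeg i 0≤c j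

sumFin-δ : ∀ n (i : Fin n) c → sumFin n (δ i c) ≡ c
sumFin-δ (suc n) zero    c = trans (cong (c +_) (sumFin-0 n)) (ℚP.+-identityʳ c)
sumFin-δ (suc n) (suc i) c = trans (ℚP.+-identityˡ _) (sumFin-δ n i c)

sumFin-δ* : ∀ n (i : Fin n) c (f : Fin n → ℚ) → sumFin n (λ j → δ i c j * f j) ≡ c * f i
sumFin-δ* (suc n) zero c f = begin
  c * f zero + sumFin n (λ j → 0ℚ * f (suc j)) ≡⟨ cong (c * f zero +_) (sumFin-cong n (λ j → ℚP.*-zeroˡ (f (suc j)))) ⟩
  c * f zero + sumFin n (λ _ → 0ℚ)             ≡⟨ cong (c * f zero +_) (sumFin-0 n) ⟩
  c * f zero + 0ℚ                              ≡⟨ ℚP.+-identityʳ _ ⟩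
  c * f zero                                   ∎
  where open ≡-Reasoning
sumFin-δ* (suc n) (suc i) c f =
  trans (cong (_+ sumFin n (λ j → δ i c j * f (suc j))) (ℚP.*-zeroˡ (f zero))) (trans (ℚP.+-identityˡ _) (sumFin-δ* n i c (f ∘ suc)))

-- Gordan's theorem by Fourier–Motzkin elimination

below : ∀ us → ∃ λ t → ∀ {u} → u ∈ us → t < u
below []       = 0ℚ , λ ()
below (u ∷ us) with below us
... | t , t<us = t ⊓ u - 1ℚ , λ
  { (here refl) → ℚP.<-≤-trans (p-1<p (t ⊓ u)) (ℚP.p⊓q≤q t u)
  ; (there u∈)  → ℚP.<-≤-trans (p-1<p (t ⊓ u)) (ℚP.≤-trans (ℚP.p⊓q≤p t u) (ℚP.<⇒≤ (t<us u∈))) }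

between : ∀ l us → (∀ {u} → u ∈ us → l < u) → ∃ λ t → l < t × (∀ {u} → u ∈ us → t < u)
between l []       _    = l + 1ℚ , p<p+1 l , λ ()
between l (u ∷ us) l<us with between l us (l<us ∘ there)
... | t , l<t , t<us with ℚP.<-dense (<-⊓ l<t (l<us (here refl)))
...   | m , l<m , m<t⊓u = m , l<m , λ
  { (here refl) → ℚP.<-≤-trans m<t⊓u (ℚP.p⊓q≤q t u)
  ; (there u∈)  → ℚP.<-trans (ℚP.<-≤-trans m<t⊓u (ℚP.p⊓q≤p t u)) (t<us u∈) }

separate : ∀ ls us → (∀ {l u} → l ∈ ls → u ∈ us → l < u) →
  ∃ λ t → (∀ {l} → l ∈ ls → l < t) × (∀ {u} → u ∈ us → t < u)
separate []       us _     = let t , t<us = below us in t , (λ ()) , t<us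
separate (l ∷ ls) us ls<us with separate ls us (ls<us ∘ there)
... | t , ls<t , t<us with between (l ⊔ t) us (λ u∈ → ⊔-< (ls<us (here refl) u∈) (t<us u∈))
...   | t′ , l⊔t<t′ , t′<us = t′ , (λ
  { (here refl) → ℚP.≤-<-trans (ℚP.p≤p⊔q l t) l⊔t<t′
  ; (there l∈)  → ℚP.<-trans (ls<t l∈) (ℚP.≤-<-trans (ℚP.p≤q⊔p l t) l⊔t<t′) }) , t′<us

infix 7 _·_
_·_ : ∀ {n} → Vector ℚ n → Vector ℚ n → ℚ
_·_ {n} a y = sumFin n (λ j → a j * y j)

·-linear : ∀ {n} s r (a b y : Vector ℚ n) →
  (λ j → s * a j + r * b j) · y ≡ s * (a · y) + r * (b · y)
·-linear {n} s r a b y = begin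
  sumFin n (λ j → (s * a j + r * b j) * y j)          ≡⟨ sumFin-cong n distrib ⟩
  sumFin n (λ j → s * (a j * y j) + r * (b j * y j))  ≡⟨ sumFin-+ n _ _ ⟩
  sumFin n (λ j → s * (a j * y j)) + sumFin n (λ j → r * (b j * y j))
                                                      ≡⟨ cong₂ _+_ (sumFin-*ˡ n s _) (sumFin-*ˡ n r _) ⟩
  s * (a · y) + r * (b · y)                           ∎
  where
  open ≡-Reasoning
  distrib : ∀ j → (s * a j + r * b j) * y j ≡ s * (a j * y j) + r * (b j * y j)
  distrib j = solve 5 (λ s r a b y → (s :* a :+ r :* b) :* y := s :* (a :* y) :+ r :* (b :* y))
                      refl s r (a j) (b j) (y j)

record Term {n} (L : List (Vector ℚ n)) : Set where
  constructor term
  field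
    coeff   : ℚ
    coeff≥0 : 0ℚ ≤ coeff
    vec     : Vector ℚ n
    vec∈L   : vec ∈ L
open Term

Active : ∀ {n} {L : List (Vector ℚ n)} → Term L → Set
Active t = 0ℚ < coeff t

combination : ∀ {n} {L : List (Vector ℚ n)} → List (Term L) → Vector ℚ n
combination []                  j = 0ℚ
combination (term c _ v _ ∷ ts) j = c * v j + combination ts j

combination-++ : ∀ {n} {L : List (Vector ℚ n)} (ts us : List (Term L)) j →
  combination (ts ++ us) j ≡ combination ts j + combination us j
combination-++ []                  us j = sym (ℚP.+-identityˡ _)
combination-++ (term c _ v _ ∷ ts) us j =
  trans (cong (c * v j +_) (combination-++ ts us j)) (sym (ℚP.+-assoc (c * v j) _ _))

Alternative : ∀ {n} → List (Vector ℚ n) → Set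
Alternative L =
  (∃ λ y → ∀ {a} → a ∈ L → a · y < 0ℚ) ⊎
  (∃ λ ts → Any Active ts × ∀ j → combination {L = L} ts j ≡ 0ℚ)

-- One step of Fourier–Motzkin elimination: L′ consists of the rows of L with
-- first coordinate 0 and, for every row p with positive and q with negative
-- first coordinate, the combination σ⁺ p · p + σ⁻ q · q, in which it cancels.
module FourierMotzkin {n} (L : List (Vector ℚ (suc n))) where

  Zs Ps Ns : List (Vector ℚ (suc n))
  Zs = filter (λ a → a zero ℚP.≟ 0ℚ) L
  Ps = filter (λ a → 0ℚ ℚP.<? a zero) L
  Ns = filter (λ a → a zero ℚP.<? 0ℚ) L

  σ⁺ σ⁻ : Vector ℚ (suc n) → ℚ
  σ⁺ p = inv (p zero)
  σ⁻ q = inv (- q zero)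

  σ⁺-pos : ∀ p → 0ℚ < p zero → 0ℚ < σ⁺ p
  σ⁺-pos p = inv-pos

  σ⁻-pos : ∀ q → q zero < 0ℚ → 0ℚ < σ⁻ q
  σ⁻-pos q = inv-pos ∘ ℚP.neg-antimono-<

  σ⁺-normalises : ∀ p → 0ℚ < p zero → σ⁺ p * p zero ≡ 1ℚ
  σ⁺-normalises p = inv-inverseˡ

  σ⁻-normalises : ∀ q → q zero < 0ℚ → σ⁻ q * q zero ≡ - 1ℚ
  σ⁻-normalises q q₀<0 = begin
    σ⁻ q * q zero          ≡⟨ solve 2 (λ s x → s :* x := :- (s :* (:- x))) refl (σ⁻ q) (q zero) ⟩
    - (σ⁻ q * - q zero)    ≡⟨ cong -_ (inv-inverseˡ (ℚP.neg-antimono-< q₀<0)) ⟩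
    - 1ℚ                   ∎
    where open ≡-Reasoning

  eliminate : Vector ℚ (suc n) → Vector ℚ (suc n) → Vector ℚ n
  eliminate p q j = σ⁺ p * p (suc j) + σ⁻ q * q (suc j)

  L′ : List (Vector ℚ n)
  L′ = map tail Zs ++ cartesianProductWith eliminate Ps Ns

  data Origin (v : Vector ℚ n) : Set where
    unchanged  : ∀ {a} → a ∈ L → a zero ≡ 0ℚ → v ≡ tail a → Origin v
    eliminated : ∀ {p q} → p ∈ L → q ∈ L → 0ℚ < p zero → q zero < 0ℚ →
                 v ≡ eliminate p q → Origin v

  origin : ∀ {v} → v ∈ L′ → Origin v
  origin v∈L′ with ∈-++⁻ (map tail Zs) v∈L′
  ... | inj₁ v∈Z =
    let a , a∈Zs , v≡ = ∈-map⁻ tail v∈Z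
        a∈L , a₀≡0 = ∈-filter⁻ (λ a → a zero ℚP.≟ 0ℚ) {xs = L} a∈Zs
    in unchanged a∈L a₀≡0 v≡
  ... | inj₂ v∈PN =
    let p , q , p∈Ps , q∈Ns , v≡ = ∈-cartesianProductWith⁻ eliminate Ps Ns v∈PN
        p∈L , 0<p₀ = ∈-filter⁻ (λ a → 0ℚ ℚP.<? a zero) {xs = L} p∈Ps
        q∈L , q₀<0 = ∈-filter⁻ (λ a → a zero ℚP.<? 0ℚ) {xs = L} q∈Ns
    in eliminated p∈L q∈L 0<p₀ q₀<0 v≡

  expand : ∀ {v} c → 0ℚ ≤ c → Origin v → List (Term L)
  expand c 0≤c (unchanged {a} a∈L _ _) = term c 0≤c a a∈L ∷ []
  expand c 0≤c (eliminated {p} {q} p∈L q∈L 0<p₀ q₀<0 _) =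
    term (c * σ⁺ p) (*-nonNeg 0≤c (ℚP.<⇒≤ (σ⁺-pos p 0<p₀))) p p∈L ∷
    term (c * σ⁻ q) (*-nonNeg 0≤c (ℚP.<⇒≤ (σ⁻-pos q q₀<0))) q q∈L ∷ []

  expand-head : ∀ {v} c 0≤c (o : Origin v) → combination (expand c 0≤c o) zero ≡ 0ℚ
  expand-head c 0≤c (unchanged {a} _ a₀≡0 _) =
    trans (ℚP.+-identityʳ _) (trans (cong (c *_) a₀≡0) (ℚP.*-zeroʳ c))
  expand-head c 0≤c (eliminated {p} {q} _ _ 0<p₀ q₀<0 _) = begin
    c * σ⁺ p * p zero + (c * σ⁻ q * q zero + 0ℚ)
      ≡⟨ solve 5 (λ c s x t z → c :* s :* x :+ (c :* t :* z :+ con 0ℚ) := c :* (s :* x :+ t :* z))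
               refl c (σ⁺ p) (p zero) (σ⁻ q) (q zero) ⟩
    c * (σ⁺ p * p zero + σ⁻ q * q zero)
      ≡⟨ cong (c *_) (cong₂ _+_ (σ⁺-normalises p 0<p₀) (σ⁻-normalises q q₀<0)) ⟩
    c * (1ℚ - 1ℚ)
      ≡⟨ ℚP.*-zeroʳ c ⟩
    0ℚ ∎
    where open ≡-Reasoning

  expand-tail : ∀ {v} c 0≤c (o : Origin v) j → combination (expand c 0≤c o) (suc j) ≡ c * v j
  expand-tail c 0≤c (unchanged _ _ refl) j = ℚP.+-identityʳ _
  expand-tail c 0≤c (eliminated {p} {q} _ _ _ _ refl) j =
    solve 5 (λ c s x t z → c :* s :* x :+ (c :* t :* z :+ con 0ℚ) := c :* (s :* x :+ t :* z))
          refl c (σ⁺ p) (p (suc j)) (σ⁻ q) (q (suc j))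

  expand-active : ∀ {v} c 0≤c (o : Origin v) → 0ℚ < c → Any Active (expand c 0≤c o)
  expand-active c 0≤c (unchanged _ _ _)             0<c = here 0<c
  expand-active c 0≤c (eliminated {p} _ _ 0<p₀ _ _) 0<c = here (*-pos 0<c (σ⁺-pos p 0<p₀))

  lift : List (Term L′) → List (Term L)
  lift []                       = []
  lift (term c 0≤c _ v∈L′ ∷ ts) = expand c 0≤c (origin v∈L′) ++ lift ts

  lift-head : ∀ ts → combination (lift ts) zero ≡ 0ℚ
  lift-head []                       = refl
  lift-head (term c 0≤c _ v∈L′ ∷ ts) =
    trans (combination-++ (expand c 0≤c (origin v∈L′)) (lift ts) zero)
          (trans (cong₂ _+_ (expand-head c 0≤c (origin v∈L′)) (lift-head ts)) (ℚP.+-identityʳ 0ℚ))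

  lift-tail : ∀ ts j → combination (lift ts) (suc j) ≡ combination ts j
  lift-tail []                       j = refl
  lift-tail (term c 0≤c _ v∈L′ ∷ ts) j =
    trans (combination-++ (expand c 0≤c (origin v∈L′)) (lift ts) (suc j))
          (cong₂ _+_ (expand-tail c 0≤c (origin v∈L′) j) (lift-tail ts j))

  lift-active : ∀ ts → Any Active ts → Any Active (lift ts)
  lift-active (term c 0≤c _ v∈L′ ∷ ts) (here 0<c) = Any.++⁺ˡ (expand-active c 0≤c (origin v∈L′) 0<c)
  lift-active (term c 0≤c _ v∈L′ ∷ ts) (there a)  = Any.++⁺ʳ (expand c 0≤c (origin v∈L′)) (lift-active ts a)

  -- A row a of L with a₀ ≠ 0 bounds t = y₀ on one side by -(tail a · y′)/a₀;
  -- the rows of L′ coming from pairs say that every lower bound is below every upper bound.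
  module Extend (y′ : Vector ℚ n) (L′<0 : ∀ {a} → a ∈ L′ → a · y′ < 0ℚ) where

    lower upper : Vector ℚ (suc n) → ℚ
    lower q = σ⁻ q * (tail q · y′)
    upper p = - (σ⁺ p * (tail p · y′))

    lower<upper : ∀ {l u} → l ∈ map lower Ns → u ∈ map upper Ps → l < u
    lower<upper l∈ u∈ with ∈-map⁻ lower l∈ | ∈-map⁻ upper u∈
    ... | q , q∈Ns , refl | p , p∈Ps , refl =
      +<0⇒<-neg (σ⁺ p * (tail p · y′)) (lower q)
        (subst (_< 0ℚ) (·-linear (σ⁺ p) (σ⁻ q) (tail p) (tail q) y′)
               (L′<0 (∈-++⁺ʳ (map tail Zs) (∈-cartesianProductWith⁺ eliminate p∈Ps q∈Ns))))

    extend : ∃ λ y → ∀ {a} → a ∈ L → a · y < 0ℚ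
    extend with separate (map lower Ns) (map upper Ps) lower<upper
    ... | t , Ns<t , t<Ps = t ◂ y′ , solution
      where
      solution : ∀ {a} → a ∈ L → a zero * t + tail a · y′ < 0ℚ
      solution {a} a∈L with ℚP.<-cmp (a zero) 0ℚ
      ... | tri≈ _ a₀≡0 _ = subst (_< 0ℚ)
        (sym (trans (cong (λ x → x * t + tail a · y′) a₀≡0)
                    (trans (cong (_+ tail a · y′) (ℚP.*-zeroˡ t)) (ℚP.+-identityˡ _))))
        (L′<0 (∈-++⁺ˡ (∈-map⁺ tail (∈-filter⁺ (λ a → a zero ℚP.≟ 0ℚ) {xs = L} a∈L a₀≡0))))
      ... | tri> _ _ 0<a₀ = <-neg⇒+<0 (a zero * t) (tail a · y′)
        (subst (a zero * t <_) a₀*upper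
          (ℚP.*-monoʳ-<-pos (a zero) {{ℚ.positive 0<a₀}}
            (t<Ps (∈-map⁺ upper (∈-filter⁺ (λ a → 0ℚ ℚP.<? a zero) {xs = L} a∈L 0<a₀)))))
        where
        a₀*upper : a zero * upper a ≡ - (tail a · y′)
        a₀*upper = trans (solve 3 (λ x s d → x :* (:- (s :* d)) := :- ((s :* x) :* d)) refl
                                  (a zero) (σ⁺ a) (tail a · y′))
                         (trans (cong (λ s → - (s * (tail a · y′))) (σ⁺-normalises a 0<a₀))
                                (cong -_ (ℚP.*-identityˡ _)))
      ... | tri< a₀<0 _ _ = <-neg⇒+<0 (a zero * t) (tail a · y′)
        (subst (a zero * t <_) a₀*lower
          (ℚP.*-monoʳ-<-neg (a zero) {{ℚ.negative a₀<0}}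
            (Ns<t (∈-map⁺ lower (∈-filter⁺ (λ a → a zero ℚP.<? 0ℚ) {xs = L} a∈L a₀<0)))))
        where
        a₀*lower : a zero * lower a ≡ - (tail a · y′)
        a₀*lower = trans (solve 3 (λ x s d → x :* (s :* d) := (s :* x) :* d) refl
                                  (a zero) (σ⁻ a) (tail a · y′))
                         (trans (cong (_* (tail a · y′)) (σ⁻-normalises a a₀<0))
                                (trans (sym (ℚP.neg-distribˡ-* 1ℚ (tail a · y′))) (cong -_ (ℚP.*-identityˡ _))))

gordan-list : ∀ n (L : List (Vector ℚ n)) → Alternative L
gordan-list zero    []      = inj₁ ((λ ()) , λ ())
gordan-list zero    (a ∷ _) = inj₂ (term 1ℚ (ℚP.<⇒≤ 0<1) a (here refl) ∷ [] , here 0<1 , λ ())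
gordan-list (suc n) L with gordan-list n (FourierMotzkin.L′ L)
... | inj₁ (y′ , L′<0)         = inj₁ (Extend.extend y′ L′<0)
  where open FourierMotzkin L
... | inj₂ (ts , active , ts≡0) = inj₂ (lift ts , lift-active ts active , λ
  { zero    → lift-head ts
  ; (suc j) → trans (lift-tail ts j) (ts≡0 j) })
  where open FourierMotzkin L

lincomb : ∀ {m n} → Vector ℚ m → (Fin m → Vector ℚ n) → Vector ℚ n
lincomb {m} c A j = sumFin m (λ r → c r * A r j)

lincomb-0 : ∀ {m n} (A : Fin m → Vector ℚ n) j → lincomb (λ _ → 0ℚ) A j ≡ 0ℚ
lincomb-0 {m} A j = trans (sumFin-cong m (λ r → ℚP.*-zeroˡ (A r j))) (sumFin-0 m)

module Coefficients {m n} (A : Fin m → Vector ℚ n) where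

  Rows : List (Vector ℚ n)
  Rows = map A (allFin m)

  index : ∀ {v} → v ∈ Rows → Fin m
  index v∈ = proj₁ (∈-map⁻ A v∈)

  index-row : ∀ {v} (v∈ : v ∈ Rows) → v ≡ A (index v∈)
  index-row v∈ = proj₂ (proj₂ (∈-map⁻ A v∈))

  coefficients : List (Term Rows) → Vector ℚ m
  coefficients []                   r = 0ℚ
  coefficients (term c _ _ v∈ ∷ ts) r = δ (index v∈) c r + coefficients ts r

  coefficients-nonNeg : ∀ ts r → 0ℚ ≤ coefficients ts r
  coefficients-nonNeg []                     r = ℚP.≤-refl
  coefficients-nonNeg (term c 0≤c _ v∈ ∷ ts) r =
    +-nonNeg (δ-nonNeg (index v∈) 0≤c r) (coefficients-nonNeg ts r)

  sumFin-coefficients-∷ : ∀ c 0≤c v (v∈ : v ∈ Rows) ts →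
    sumFin m (coefficients (term c 0≤c v v∈ ∷ ts)) ≡ c + sumFin m (coefficients ts)
  sumFin-coefficients-∷ c _ _ v∈ ts =
    trans (sumFin-+ m (δ (index v∈) c) (coefficients ts)) (cong (_+ _) (sumFin-δ m (index v∈) c))

  sumFin-coefficients-pos : ∀ ts → Any Active ts → 0ℚ < sumFin m (coefficients ts)
  sumFin-coefficients-pos (term c 0≤c v v∈ ∷ ts) (here 0<c) =
    subst (0ℚ <_) (sym (sumFin-coefficients-∷ c 0≤c v v∈ ts))
          (ℚP.<-≤-trans 0<c (p≤p+q (sumFin-nonNeg m (coefficients-nonNeg ts))))
  sumFin-coefficients-pos (term c 0≤c v v∈ ∷ ts) (there active) =
    subst (0ℚ <_) (sym (sumFin-coefficients-∷ c 0≤c v v∈ ts))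
          (ℚP.<-≤-trans (sumFin-coefficients-pos ts active) (q≤p+q 0≤c))

  combination≡lincomb : ∀ ts j → combination ts j ≡ lincomb (coefficients ts) A j
  combination≡lincomb []                   j = sym (lincomb-0 A j)
  combination≡lincomb (term c _ v v∈ ∷ ts) j = begin
    c * v j + combination ts j
      ≡⟨ cong₂ _+_ (cong (λ u → c * u j) (index-row v∈)) (combination≡lincomb ts j) ⟩
    c * A i j + lincomb C A j
      ≡⟨ cong (_+ lincomb C A j) (sym (sumFin-δ* m i c (λ r → A r j))) ⟩
    sumFin m (λ r → δ i c r * A r j) + lincomb C A j
      ≡⟨ sym (sumFin-+ m _ _) ⟩
    sumFin m (λ r → δ i c r * A r j + C r * A r j)
      ≡⟨ sumFin-cong m (λ r → sym (ℚP.*-distribʳ-+ (A r j) (δ i c r) (C r))) ⟩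
    lincomb (λ r → δ i c r + C r) A j ∎
    where
    open ≡-Reasoning
    i : Fin m
    i = index v∈
    C : Vector ℚ m
    C = coefficients ts

gordan : ∀ {m n} (A : Fin m → Vector ℚ n) →
  (∃ λ y → ∀ r → A r · y < 0ℚ) ⊎
  (∃ λ c → (∀ r → 0ℚ ≤ c r) × 0ℚ < sumFin m c × ∀ j → lincomb c A j ≡ 0ℚ)
gordan {m} {n} A with gordan-list n (map A (allFin m))
... | inj₁ (y , A<0)           = inj₁ (y , λ r → A<0 (∈-map⁺ A (∈-allFin r)))
... | inj₂ (ts , active , ts≡0) = inj₂ (coefficients ts , coefficients-nonNeg ts ,
  sumFin-coefficients-pos ts active , λ j → trans (sym (combination≡lincomb ts j)) (ts≡0 j))
  where open Coefficients A

augment : ∀ {m n} → (Fin m → Vector ℚ n) → Fin (m ℕ.+ n) → Vector ℚ n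
augment {m} A = [ A , (λ j → δ j (- 1ℚ)) ] ∘ splitAt m

augment-↑ˡ : ∀ {m n} (A : Fin m → Vector ℚ n) i → augment A (i ↑ˡ n) ≡ A i
augment-↑ˡ {m} {n} A i = cong [ A , (λ j → δ j (- 1ℚ)) ] (splitAt-↑ˡ m i n)

augment-↑ʳ : ∀ {m n} (A : Fin m → Vector ℚ n) j → augment A (m ↑ʳ j) ≡ δ j (- 1ℚ)
augment-↑ʳ {m} {n} A j = cong [ A , (λ j → δ j (- 1ℚ)) ] (splitAt-↑ʳ m n j)

lincomb-augment : ∀ {m n} (A : Fin m → Vector ℚ n) (c : Vector ℚ (m ℕ.+ n)) j →
  lincomb c (augment A) j ≡ lincomb (λ i → c (i ↑ˡ n)) A j - c (m ↑ʳ j)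
lincomb-augment {m} {n} A c j = begin
  lincomb c (augment A) j
    ≡⟨ sumFin-↑ m n (λ r → c r * augment A r j) ⟩
  sumFin m (λ i → c (i ↑ˡ n) * augment A (i ↑ˡ n) j) + sumFin n (λ z → c (m ↑ʳ z) * augment A (m ↑ʳ z) j)
    ≡⟨ cong₂ _+_ (sumFin-cong m (λ i → cong (λ v → c (i ↑ˡ n) * v j) (augment-↑ˡ A i)))
                 (sumFin-cong n (λ z → cong (λ v → c (m ↑ʳ z) * v j) (augment-↑ʳ A z))) ⟩
  lincomb (λ i → c (i ↑ˡ n)) A j + sumFin n (λ z → c (m ↑ʳ z) * δ z (- 1ℚ) j)
    ≡⟨ cong (lincomb (λ i → c (i ↑ˡ n)) A j +_) (begin
         sumFin n (λ z → c (m ↑ʳ z) * δ z (- 1ℚ) j)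
           ≡⟨ sumFin-cong n (λ z → trans (ℚP.*-comm (c (m ↑ʳ z)) (δ z (- 1ℚ) j)) (cong (_* c (m ↑ʳ z)) (δ-sym z j (- 1ℚ)))) ⟩
         sumFin n (λ z → δ j (- 1ℚ) z * c (m ↑ʳ z))
           ≡⟨ sumFin-δ* n j (- 1ℚ) (λ z → c (m ↑ʳ z)) ⟩
         - 1ℚ * c (m ↑ʳ j)
           ≡⟨ -1*p≡-p _ ⟩
         - c (m ↑ʳ j) ∎) ⟩
  lincomb (λ i → c (i ↑ˡ n)) A j - c (m ↑ʳ j) ∎
  where open ≡-Reasoning

ville : ∀ {m n} (A : Fin m → Vector ℚ n) →
  (∃ λ y → (∀ j → 0ℚ < y j) × ∀ r → A r · y < 0ℚ) ⊎
  (∃ λ c → (∀ r → 0ℚ ≤ c r) × 0ℚ < sumFin m c × ∀ j → 0ℚ ≤ lincomb c A j)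
ville {m} {n} A with gordan (augment A)
... | inj₁ (y , Ay<0) =
  inj₁ (y , 0<y , λ i → subst (λ v → v · y < 0ℚ) (augment-↑ˡ A i) (Ay<0 (i ↑ˡ n)))
  where
  0<y : ∀ j → 0ℚ < y j
  0<y j = -p<0⇒0<p (subst (_< 0ℚ)
    (trans (cong (_· y) (augment-↑ʳ A j)) (trans (sumFin-δ* n j (- 1ℚ) y) (-1*p≡-p (y j))))
    (Ay<0 (m ↑ʳ j)))
... | inj₂ (c , 0≤c , 0<Σc , cA≡0) =
  inj₂ (a , 0≤c ∘ (_↑ˡ n) , 0<Σa , λ j → subst (0ℚ ≤_) (sym (aA≡b j)) (0≤c (m ↑ʳ j)))
  where
  a : Vector ℚ m
  a i = c (i ↑ˡ n)
  b : Vector ℚ n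
  b j = c (m ↑ʳ j)
  aA≡b : ∀ j → lincomb a A j ≡ b j
  aA≡b j = p-q≡0⇒p≡q (trans (sym (lincomb-augment A c j)) (cA≡0 j))
  0<Σa : 0ℚ < sumFin m a
  0<Σa with 0ℚ ℚP.<? sumFin m a
  ... | yes 0<Σa = 0<Σa
  ... | no  0≮Σa = ⊥-elim (ℚP.<⇒≢ 0<Σc (sym Σc≡0))
    where
    a≡0 : ∀ i → a i ≡ 0ℚ
    a≡0 = sumFin≡0⇒≡0 m (0≤c ∘ (_↑ˡ n))
      (ℚP.≤-antisym (ℚP.≮⇒≥ 0≮Σa) (sumFin-nonNeg m (0≤c ∘ (_↑ˡ n))))
    b≡0 : ∀ j → b j ≡ 0ℚ
    b≡0 j = trans (sym (aA≡b j))
      (trans (sumFin-cong m (λ i → cong (_* A i j) (a≡0 i))) (lincomb-0 A j))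
    Σc≡0 : sumFin (m ℕ.+ n) c ≡ 0ℚ
    Σc≡0 = trans (sumFin-↑ m n c)
      (trans (cong₂ _+_ (trans (sumFin-cong m a≡0) (sumFin-0 m)) (trans (sumFin-cong n b≡0) (sumFin-0 n)))
             (ℚP.+-identityʳ 0ℚ))

-- Symmetric games

skew⇒quadratic-form≡0 : ∀ {n} (S : Fin n → Vector ℚ n) → (∀ x z → S x z ≡ - S z x) →
  ∀ y → sumFin n (λ x → y x * (S x · y)) ≡ 0ℚ
skew⇒quadratic-form≡0 {n} S skew y = p+p≡0⇒p≡0 _ (begin
  Q + Q
    ≡⟨ cong₂ _+_ expand (trans expand (sumFin-swap n n M)) ⟩
  sumFin n (λ x → sumFin n (M x)) + sumFin n (λ x → sumFin n (λ z → M z x))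
    ≡⟨ sym (sumFin-+ n _ _) ⟩
  sumFin n (λ x → sumFin n (M x) + sumFin n (λ z → M z x))
    ≡⟨ sumFin-cong n (λ x → sym (sumFin-+ n _ _)) ⟩
  sumFin n (λ x → sumFin n (λ z → M x z + M z x))
    ≡⟨ sumFin-cong n (λ x → sumFin-cong n (λ z → cancel x z)) ⟩
  sumFin n (λ x → sumFin n (λ _ → 0ℚ))
    ≡⟨ sumFin-cong n (λ _ → sumFin-0 n) ⟩
  sumFin n (λ _ → 0ℚ)
    ≡⟨ sumFin-0 n ⟩
  0ℚ ∎)
  where
  open ≡-Reasoning
  Q : ℚ
  Q = sumFin n (λ x → y x * (S x · y))
  M : Fin n → Fin n → ℚ
  M x z = y x * (S x z * y z)
  expand : Q ≡ sumFin n (λ x → sumFin n (M x))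
  expand = sumFin-cong n (λ x → sym (sumFin-*ˡ n (y x) (λ z → S x z * y z)))
  cancel : ∀ x z → M x z + M z x ≡ 0ℚ
  cancel x z = trans (cong (λ s → M x z + y z * (s * y x)) (skew z x))
    (solve 3 (λ a s b → a :* (s :* b) :+ b :* ((:- s) :* a) := con 0ℚ) refl (y x) (S x z) (y z))

skew-symmetric-game : ∀ n .{{_ : NonZero n}} (S : Fin n → Vector ℚ n) → (∀ x z → S x z ≡ - S z x) →
  ∃ λ w → ((∀ y → 0ℚ ≤ w y) × sumFin n w ≡ 1ℚ) × ∀ x → 0ℚ ≤ lincomb w S x
skew-symmetric-game n@(suc n′) S skew with ville S
... | inj₁ (y , 0<y , Sy<0) = ⊥-elim (ℚP.<⇒≢ form<0 (skew⇒quadratic-form≡0 S skew y))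
  where
  form<0 : sumFin n (λ x → y x * (S x · y)) < 0ℚ
  form<0 = sumFin<0 n′ (λ x →
    subst (y x * (S x · y) <_) (ℚP.*-zeroʳ (y x)) (ℚP.*-monoʳ-<-pos (y x) {{ℚ.positive (0<y x)}} (Sy<0 x)))
... | inj₂ (c , 0≤c , 0<Σc , 0≤cS) = w , (0≤w , Σw≡1) , 0≤wS
  where
  ι : ℚ
  ι = inv (sumFin n c)
  w : Vector ℚ n
  w y = ι * c y
  0≤w : ∀ y → 0ℚ ≤ w y
  0≤w y = *-nonNeg (ℚP.<⇒≤ (inv-pos 0<Σc)) (0≤c y)
  Σw≡1 : sumFin n w ≡ 1ℚ
  Σw≡1 = trans (sumFin-*ˡ n ι c) (inv-inverseˡ 0<Σc)
  0≤wS : ∀ x → 0ℚ ≤ lincomb w S x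
  0≤wS x = subst (0ℚ ≤_)
    (trans (sym (sumFin-*ˡ n ι (λ y → c y * S y x))) (sumFin-cong n (λ y → sym (ℚP.*-assoc ι (c y) (S y x)))))
    (*-nonNeg (ℚP.<⇒≤ (inv-pos 0<Σc)) (0≤cS x))

fromℕ : ℕ → ℚ
fromℕ m = sumFin m (λ _ → 1ℚ)

sumFin-const : ∀ n c → sumFin n (λ _ → c) ≡ fromℕ n * c
sumFin-const n c = trans (sumFin-cong n (λ _ → sym (ℚP.*-identityˡ c))) (sumFin-*ʳ n c (λ _ → 1ℚ))

fromℕ-+ : ∀ m n → fromℕ (m ℕ.+ n) ≡ fromℕ m + fromℕ n
fromℕ-+ m n = sumFin-↑ m n (λ _ → 1ℚ)

fromℕ-pos : ∀ m → 0ℚ < fromℕ (suc m)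
fromℕ-pos m = ℚP.<-≤-trans 0<1 (p≤p+q (sumFin-nonNeg m (λ _ → ℚP.<⇒≤ 0<1)))

toℚᵘ-fromℕ : ∀ m → ℚ.toℚᵘ (fromℕ m) ℚᵘ.≃ ℚᵘ.mkℚᵘ (pos m) 0
toℚᵘ-fromℕ zero    = ℚᵘ.*≡* refl
toℚᵘ-fromℕ (suc m) = ℚᵘP.≃-trans (ℚP.toℚᵘ-homo-+ 1ℚ (fromℕ m))
  (ℚᵘP.≃-trans (ℚᵘP.+-congʳ (ℚ.toℚᵘ 1ℚ) (toℚᵘ-fromℕ m)) (ℚᵘ.*≡* cross))
  where
  cross : ((pos 1 ℤ.* pos 1) ℤ.+ (pos m ℤ.* pos 1)) ℤ.* pos 1 ≡ pos (suc m) ℤ.* (pos 1 ℤ.* pos 1)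
  cross = trans (ℤP.*-identityʳ _)
    (trans (cong (ℤ._+_ (pos 1)) (ℤP.*-identityʳ (pos m))) (sym (ℤP.*-identityʳ (pos (suc m)))))

1/n*n≡1 : ∀ m → (pos 1 ℚ./ suc m) * fromℕ (suc m) ≡ 1ℚ
1/n*n≡1 m = ℚP.toℚᵘ-injective
  (ℚᵘP.≃-trans (ℚP.toℚᵘ-homo-* (pos 1 ℚ./ suc m) (fromℕ (suc m)))
  (ℚᵘP.≃-trans (ℚᵘP.*-cong (ℚP.toℚᵘ-fromℚᵘ (ℚᵘ.mkℚᵘ (pos 1) m)) (toℚᵘ-fromℕ (suc m)))
               (ℚᵘ.*≡* cross)))
  where
  cross : (pos 1 ℤ.* pos (suc m)) ℤ.* pos 1 ≡ pos 1 ℤ.* pos (suc m ℕ.* 1)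
  cross = trans (ℤP.*-identityʳ _) (cong (ℤ._*_ (pos 1) ∘ pos) (sym (ℕP.*-identityʳ (suc m))))

inv2k*2k≡1 : ∀ k .{{_ : NonZero k}} → inv2k k * fromℕ (2 ℕ.* k) ≡ 1ℚ
inv2k*2k≡1 (suc k) = 1/n*n≡1 (k ℕ.+ suc (k ℕ.+ 0))

argmax : ∀ m (f : Fin (suc m) → ℚ) → ∃ λ i → ∀ j → f j ≤ f i
argmax zero    f = zero , λ { zero → ℚP.≤-refl }
argmax (suc m) f with argmax m (f ∘ suc)
... | i , f≤fi with f zero ℚP.≤? f (suc i)
...   | yes f0≤fi = suc i , λ { zero → f0≤fi ; (suc j) → f≤fi j }
...   | no  f0≰fi = zero , λ { zero → ℚP.≤-refl ; (suc j) → ℚP.≤-trans (f≤fi j) (ℚP.<⇒≤ (ℚP.≰⇒> f0≰fi)) }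

pigeonhole : ∀ k .{{_ : NonZero k}} (F : Fin k → ℚ) →
  1ℚ ≤ sumFin k F + sumFin k F → ∃ λ i → inv2k k ≤ F i
pigeonhole k@(suc k′) F half≤ΣF with argmax k′ F
... | i , F≤Fi = i , ℚP.*-cancelʳ-≤-pos (fromℕ (2 ℕ.* k)) {{ℚ.positive (fromℕ-pos (k′ ℕ.+ 1 ℕ.* k))}} (begin
  inv2k k * fromℕ (2 ℕ.* k)         ≡⟨ inv2k*2k≡1 k ⟩
  1ℚ                                ≤⟨ half≤ΣF ⟩
  sumFin k F + sumFin k F           ≤⟨ ℚP.+-mono-≤ ΣF≤kFi ΣF≤kFi ⟩
  fromℕ k * F i + fromℕ k * F i     ≡⟨ sym (ℚP.*-distribʳ-+ (F i) (fromℕ k) (fromℕ k)) ⟩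
  (fromℕ k + fromℕ k) * F i         ≡⟨ cong (_* F i) (sym (fromℕ-2* k)) ⟩
  fromℕ (2 ℕ.* k) * F i             ≡⟨ ℚP.*-comm _ (F i) ⟩
  F i * fromℕ (2 ℕ.* k)             ∎)
  where
  open ℚP.≤-Reasoning
  ΣF≤kFi : sumFin k F ≤ fromℕ k * F i
  ΣF≤kFi = subst (sumFin k F ≤_) (sumFin-const k (F i)) (sumFin-mono k F≤Fi)
  fromℕ-2* : ∀ m → fromℕ (2 ℕ.* m) ≡ fromℕ m + fromℕ m
  fromℕ-2* m = trans (fromℕ-+ m (m ℕ.+ 0)) (cong (λ m′ → fromℕ m + fromℕ m′) (ℕP.+-identityʳ m))

-- Arcs of the multidigraph

closedIn-refl : ∀ {n} (R : Rel n) x → closedIn R x x ≡ true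
closedIn-refl R x with x ≟ x
... | yes _   = refl
... | no  x≢x = ⊥-elim (x≢x refl)

closedIn-rel : ∀ {n} (R : Rel n) {x y} → R y x ≡ true → closedIn R x y ≡ true
closedIn-rel R {x} {y} Ryx with y ≟ x
... | yes _ = refl
... | no  _ = Ryx

𝟙 : Bool → ℚ
𝟙 true  = 1ℚ
𝟙 false = 0ℚ

if-nonNeg : ∀ b {p} → 0ℚ ≤ p → 0ℚ ≤ (if b then p else 0ℚ)
if-nonNeg true  0≤p = 0≤p
if-nonNeg false _   = ℚP.≤-refl

module Arcs {k n} (P : Fin k → Rel n) where

  Arc : Fin n → Fin n → Set
  Arc y x = ∃ λ i → closedIn (P i) x y ≡ true

  _⇒?_ : ∀ y x → Dec (Arc y x)
  y ⇒? x = any? (λ i → closedIn (P i) x y Bool.≟ true)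

  arc-total : Fin k → IsCompleteUnion P → ∀ y x → Arc y x ⊎ Arc x y
  arc-total i₀ complete y x = decide (x ≟ y)
    where
    decide : Dec (x ≡ y) → Arc y x ⊎ Arc x y
    decide (yes x≡y) = inj₁ (i₀ , subst (λ z → closedIn (P i₀) x z ≡ true) x≡y (closedIn-refl (P i₀) x))
    decide (no  x≢y) with complete x y x≢y
    ... | i , inj₁ Pxy = inj₂ (i , closedIn-rel (P i) Pxy)
    ... | i , inj₂ Pyx = inj₁ (i , closedIn-rel (P i) Pyx)

  [_⇒_] : Fin n → Fin n → ℚ
  [ y ⇒ x ] = 𝟙 (does (y ⇒? x))

  S : Fin n → Vector ℚ n
  S y x = [ y ⇒ x ] - [ x ⇒ y ]

  S-skew : ∀ y x → S y x ≡ - S x y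
  S-skew y x = solve 2 (λ a b → a :- b := :- (b :- a)) refl [ y ⇒ x ] [ x ⇒ y ]

  1+S≤2[⇒] : Fin k → IsCompleteUnion P → ∀ y x → 1ℚ + S y x ≤ [ y ⇒ x ] + [ y ⇒ x ]
  1+S≤2[⇒] i₀ complete y x with y ⇒? x | x ⇒? y
  ... | yes _   | yes _   = from-yes (1ℚ + (1ℚ - 1ℚ) ℚP.≤? 1ℚ + 1ℚ)
  ... | yes _   | no  _   = ℚP.≤-refl
  ... | no  _   | yes _   = ℚP.≤-refl
  ... | no ¬y⇒x | no ¬x⇒y = ⊥-elim ([ ¬y⇒x , ¬x⇒y ]′ (arc-total i₀ complete y x))

  [⇒]-weight : ∀ (w : Vector ℚ n) y x → 0ℚ ≤ w y →
    w y * [ y ⇒ x ] ≤ sumFin k (λ i → if closedIn (P i) x y then w y else 0ℚ)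
  [⇒]-weight w y x 0≤wy with y ⇒? x
  ... | yes (i , y∈Nx) = subst₂ _≤_
    (trans (cong (λ b → if b then w y else 0ℚ) y∈Nx) (sym (ℚP.*-identityʳ (w y)))) refl
    (term≤sumFin k (λ j → if-nonNeg (closedIn (P j) x y) 0≤wy) i)
  ... | no  _ = subst (_≤ sumFin k (λ i → if closedIn (P i) x y then w y else 0ℚ)) (sym (ℚP.*-zeroʳ (w y)))
    (sumFin-nonNeg k (λ j → if-nonNeg (closedIn (P j) x y) 0≤wy))

  half≤Σweight : Fin k → IsCompleteUnion P → (w : Vector ℚ n) → (∀ y → 0ℚ ≤ w y) → sumFin n w ≡ 1ℚ →
    ∀ x → 0ℚ ≤ lincomb w S x →
    1ℚ ≤ sumFin k (λ i → weight w (closedIn (P i) x)) + sumFin k (λ i → weight w (closedIn (P i) x))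
  half≤Σweight i₀ complete w 0≤w Σw≡1 x 0≤wS = begin
    1ℚ                                 ≡⟨ sym Σw≡1 ⟩
    sumFin n w                         ≤⟨ p≤p+q 0≤wS ⟩
    sumFin n w + lincomb w S x         ≡⟨ sym (sumFin-+ n w (λ y → w y * S y x)) ⟩
    sumFin n (λ y → w y + w y * S y x) ≤⟨ sumFin-mono n pointwise ⟩
    sumFin n (λ y → G y + G y)         ≡⟨ sumFin-+ n G G ⟩
    sumFin n G + sumFin n G            ≡⟨ cong₂ _+_ swap swap ⟩
    sumFin k (λ i → weight w (closedIn (P i) x)) + sumFin k (λ i → weight w (closedIn (P i) x)) ∎
    where
    open ℚP.≤-Reasoning
    G : Vector ℚ n
    G y = sumFin k (λ i → if closedIn (P i) x y then w y else 0ℚ)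
    swap : sumFin n G ≡ sumFin k (λ i → weight w (closedIn (P i) x))
    swap = sumFin-swap n k (λ y i → if closedIn (P i) x y then w y else 0ℚ)
    pointwise : ∀ y → w y + w y * S y x ≤ G y + G y
    pointwise y = begin
      w y + w y * S y x                   ≡⟨ solve 2 (λ a s → a :+ a :* s := a :* (con 1ℚ :+ s)) refl (w y) (S y x) ⟩
      w y * (1ℚ + S y x)                  ≤⟨ ℚP.*-monoˡ-≤-nonNeg (w y) {{ℚ.nonNegative (0≤w y)}} (1+S≤2[⇒] i₀ complete y x) ⟩
      w y * ([ y ⇒ x ] + [ y ⇒ x ])       ≡⟨ ℚP.*-distribˡ-+ (w y) [ y ⇒ x ] [ y ⇒ x ] ⟩
      w y * [ y ⇒ x ] + w y * [ y ⇒ x ]   ≤⟨ ℚP.+-mono-≤ (weight≤ y) (weight≤ y) ⟩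
      G y + G y                           ∎
      where
      weight≤ : ∀ y → w y * [ y ⇒ x ] ≤ G y
      weight≤ y = [⇒]-weight w y x (0≤w y)

lemma1 : (k n : ℕ) → .{{_ : NonZero k}} → .{{_ : NonZero n}} →
    (P : Fin k → Rel n) →
    (∀ i → IsQuasiOrder (P i)) →
    IsCompleteUnion P →
    ∃₂ λ (w : Fin n → ℚ) (part : Fin n → Fin k) →
    ((∀ x → (0ℚ ≤ w x) × (w x ≤ 1ℚ)) × (sumFin n w ≡ 1ℚ)) ×
    (∀ (x : Fin n) → inv2k k ≤ weight w (closedIn (P (part x)) x))
lemma1 k@(suc _) n P _ complete =
  let w , (0≤w , Σw≡1) , 0≤wS = skew-symmetric-game n S S-skew
      best : ∀ x → ∃ λ i → inv2k k ≤ weight w (closedIn (P i) x)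
      best x = pigeonhole k _ (half≤Σweight zero complete w 0≤w Σw≡1 x (0≤wS x))
  in w , proj₁ ∘ best , ((λ x → 0≤w x , subst (w x ≤_) Σw≡1 (term≤sumFin n 0≤w x)) , Σw≡1) , proj₂ ∘ best
  where open Arcs P
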